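{- Let $q$ be an odd prime power such that $-1$ is a nonsquare in $\mathbb{F}=\mathbb{F}_q$. Then $S_{00}^{00}=S_{00}^{11}=\emptyset$, and for $(x,y)\in S$: \begin{itemize} \item $(x,y)\in S_{01}^{10}$ iff $(x,y)\in S_{10}^{01}$ iff $(1-y)(x-y)$ and $(1-x)(y-x)$ are nonzero squares; \item $(x,y)\in S_{01}^{00}$ iff $(x-1)(y-x)$ and $(x^2-2x+y)(y-x)$ are nonzero squares. \end{itemize}
   Context: A square is an element $z^2$, $z\in\mathbb{F}$; a nonsquare is an element that is not a square. $\Sigma$ is the set of $(a,b)\in\mathbb{F}^2$ with $a\ne b$, $a,b\notin\{0,1\}$ and $ab$, $(1-a)(1-b)$ squares. $S$ is the set of $(x,y)\in\mathbb{F}^2$ with $x,y$ squares, $x\ne y$, $\{x,y\}\cap\{0,1\}=\emptyset$. $\Psi:\Sigma\to S$ is $\Psi(a,b)=(a/b,(1-a)/(1-b))$. For $(a,b)\in\Sigma$ let $\psi=\psi_{a,b}$, $\psi(u)=au$ if $u$ is a square and $\psi(u)=bu$ if $u$ is a nonsquare. Let $E(a,b)$ be the set of $(u,v)\in\mathbb{F}^2\setminus\{(0,0)\}$ with $\psi(\psi(u)-v)=\psi(-v)+\psi(u-v-\psi(-v))$. For $i,j,r,s\in\{0,1\}$, $E_{ij}^{rs}(a,b)$ is the set of $(u,v)\in E(a,b)$ such that: $i=0$ iff $u$ is a square; $j=0$ iff $-v$ is a square; $r=0$ iff $\psi(u)-v$ is a square; $s=0$ iff $u-v-\psi(-v)$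 is a square. $\Sigma_{ij}^{rs}=\{(a,b)\in\Sigma:E_{ij}^{rs}(a,b)\ne\emptyset\}$ and $S_{ij}^{rs}=\Psi(\Sigma_{ij}^{rs})$. -}

module Defs where

open import Level using (0ℓ)
open import Data.Nat using (ℕ; _^_; _≤_; _%_)
open import Data.Nat.Primality using (Prime)
open import Data.Fin using (Fin; zero; suc)
open import Data.Fin.Properties using (any?)
open import Data.Product using (Σ; ∃; ∃-syntax; _×_; _,_; proj₁; proj₂)
open import Data.Bool using (Bool; if_then_else_)
open import Algebra.Core using (Op₁; Op₂)
open import Algebra.Structures using (IsCommutativeRing)
open import Function.Bundles using (_↔_; Inverse; mk⇔)
open import Relation.Nullary using (¬_; Dec; yes; no; does)
import Relation.Nullary.Decidable as Dec
open import Relation.Binary.Definitions using (DecidableEquality)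
open import Relation.Binary.PropositionalEquality using (_≡_; _≢_; refl; subst; cong)

record FiniteField : Set₁ where
  infixl 7 _*_
  infixl 6 _+_
  infix  8 -_
  field
    Carrier : Set
    _+_ _*_ : Op₂ Carrier
    -_      : Op₁ Carrier
    0# 1#   : Carrier
    isCommutativeRing : IsCommutativeRing _≡_ _+_ _*_ -_ 0# 1#
    0≢1     : 0# ≢ 1#
    inverse : ∀ x → x ≢ 0# → ∃[ y ] (x * y ≡ 1#)
    _≟_     : DecidableEquality Carrier
    size    : ℕ
    enum    : Fin size ↔ Carrier

OddPrimePower : ℕ → Set
OddPrimePower q = ∃[ p ] ∃[ k ] (Prime p × p % 2 ≡ 1 × 1 ≤ k × q ≡ p ^ k)

module FieldDefs (F : FiniteField) where
  open FiniteField F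

  infixl 6 _-_
  _-_ : Op₂ Carrier
  x - y = x + (- y)

  IsSquare : Carrier → Set
  IsSquare x = ∃[ z ] (z * z ≡ x)

  Nonsquare : Carrier → Set
  Nonsquare x = ¬ IsSquare x

  NonzeroSquare : Carrier → Set
  NonzeroSquare x = x ≢ 0# × IsSquare x

  isSquare? : ∀ x → Dec (IsSquare x)
  isSquare? x = Dec.map
    (mk⇔ (λ { (i , e) → Inverse.to enum i , e })
         (λ { (z , e) → Inverse.from enum z
                      , subst (λ w → w * w ≡ x) (sym' (Inverse.inverseˡ enum refl)) e }))
    (any? (λ i → (Inverse.to enum i * Inverse.to enum i) ≟ x))
    where
      sym' : ∀ {a b : Carrier} → a ≡ b → b ≡ a
      sym' refl = refl

  InΣ : Carrier → Carrier → Set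
  InΣ a b = a ≢ b × a ≢ 0# × a ≢ 1# × b ≢ 0# × b ≢ 1#
          × IsSquare (a * b) × IsSquare ((1# - a) * (1# - b))

  InS : Carrier → Carrier → Set
  InS x y = IsSquare x × IsSquare y × x ≢ y
          × x ≢ 0# × x ≢ 1# × y ≢ 0# × y ≢ 1#

  -- Ψ(a,b) = (x,y), i.e. x = a/b and y = (1-a)/(1-b) (b ≠ 0, 1 - b ≠ 0 on Σ)
  ΨIs : Carrier → Carrier → Carrier → Carrier → Set
  ΨIs a b x y = x * b ≡ a × y * (1# - b) ≡ 1# - a

  ψ : Carrier → Carrier → Carrier → Carrier
  ψ a b u = if does (isSquare? u) then a * u else b * u

  InE : Carrier → Carrier → Carrier → Carrier → Set
  InE a b u v = ¬ (u ≡ 0# × v ≡ 0#)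
              × ψ a b (ψ a b u - v) ≡ ψ a b (- v) + ψ a b (u - v - ψ a b (- v))

  Cls : Fin 2 → Carrier → Set
  Cls zero          w = IsSquare w
  Cls (suc zero)    w = Nonsquare w

  InEcls : (i j r s : Fin 2) → Carrier → Carrier → Carrier → Carrier → Set
  InEcls i j r s a b u v = InE a b u v × Cls i u × Cls j (- v)
                         × Cls r (ψ a b u - v) × Cls s (u - v - ψ a b (- v))

  InΣcls : (i j r s : Fin 2) → Carrier → Carrier → Set
  InΣcls i j r s a b = InΣ a b × ∃[ u ] ∃[ v ] InEcls i j r s a b u v

  InScls : (i j r s : Fin 2) → Carrier → Carrier → Set
  InScls i j r s x y = ∃[ a ] ∃[ b ] (InΣcls i j r s a b × ΨIs a b x y)

-- Once the classes of u, - v, ψ(u) - v and u - v - ψ(- v) are prescribed, ψ acts on each of them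
-- by a known factor (a on squares, b on nonsquares) and the equation defining E becomes polynomial.
-- For the classes 0000, 0110 and 1001 it reads (nonzero constant) (u - v) = 0, for 0011 it reads
-- b (a - 1) u = a (b - 1) v, and for 0100 it reads a u = b v. As - 1 is a nonsquare, and a product
-- of two nonsquares of a finite field is a square, this rules out 0000 and 0011, shows that
-- E₀₁¹⁰(a, b) and E₁₀⁰¹(a, b) are nonempty exactly when b and 1 - b are squares (witnessed by
-- u = v = 1 and u = v = - 1), and E₀₁⁰⁰(a, b) exactly when b - 1 and b (b - a + a b) are nonzero
-- squares (witnessed by u = b², v = a b). For (x, y) = Ψ(a, b), identities such as
--   (1 - y) (x - y) (b (1 - b))² = (a - b)² b
-- transfer these conditions on b to the stated conditions on (x, y), and every (x, y) ∈ S is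
-- Ψ(x b, b) for b = (1 - y) / (x - y).

module Submission where

open import Defs
open import Data.Fin using (Fin; zero; suc)
open import Data.Product using (_×_)
open import Function.Bundles using (_⇔_)
open import Relation.Nullary using (¬_)

open import Level using (0ℓ)
open import Algebra.Bundles using (CommutativeRing)
open import Algebra.Solver.Ring.AlmostCommutativeRing
  using (fromCommutativeRing; _-Raw-AlmostCommutative⟶_)
open import Data.Bool using (if_then_else_)
open import Data.Empty using (⊥-elim)
import Data.Fin as Fin
import Data.Fin.Properties as Fin
open import Data.Integer as ℤ using (ℤ; +_; -[1+_]; _⊖_; _◃_)
import Data.Integer.Properties as ℤ
open import Data.Maybe using (just; nothing)
import Data.Nat as ℕ
import Data.Nat.Properties as ℕ
open import Data.Product as Product using (∃-syntax; _,_; proj₁; proj₂)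
import Data.Sign as Sign
open import Data.Sum as Sum using (_⊎_; inj₁; inj₂; [_,_])
open import Function using (_∘_)
open import Function.Bundles using (Equivalence; Inverse; mk⇔)
import Function.Properties.Equivalence as ⇔
open import Function.Definitions using (Injective)
open import Data.Product.Function.NonDependent.Propositional using (_×-⇔_)
open import Relation.Binary.Definitions using (WeaklyDecidable)
open import Relation.Binary.PropositionalEquality
  using (_≡_; _≢_; refl; sym; trans; cong; cong₂; subst; ≢-sym; module ≡-Reasoning)
open import Relation.Nullary using (Dec; yes; no; contradiction)
open import Relation.Nullary.Decidable using (dec-true; dec-false)

-- Algebra.Solver.Ring needs coefficients with decidable equality mapped into R; the integers,
-- acting as multiples of 1#, serve for every commutative ring.
module IntegerCoefficientRingSolver {c ℓ} (R : CommutativeRing c ℓ) where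
  open import Data.Nat.Base using (suc)
  open CommutativeRing R hiding (refl; sym; trans)
  open CommutativeRing R using () renaming (refl to ≈-refl; sym to ≈-sym; trans to ≈-trans)
  open import Algebra.Properties.Ring ring using (-0#≈0#; -‿involutive; -‿+-comm; -‿distribˡ-*; -‿distribʳ-*)
  open import Algebra.Properties.CommutativeSemigroup +-commutativeSemigroup using (interchange)
  open import Algebra.Properties.Semiring.Mult.TCOptimised semiring using (1+×; ×-homo-+; ×1-homo-*)
    renaming (_×_ to _×ₙ_)
  open import Relation.Binary.Reasoning.Setoid setoid

  ⟦_⟧ : ℤ → Carrier
  ⟦ + n ⟧      = n ×ₙ 1#
  ⟦ -[1+ n ] ⟧ = - (suc n ×ₙ 1#)

  ⟦⟧-homo-⊖ : ∀ m n → ⟦ m ⊖ n ⟧ ≈ m ×ₙ 1# - n ×ₙ 1#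
  ⟦⟧-homo-⊖ m       0       = begin
    m ×ₙ 1#       ≈⟨ +-identityʳ _ ⟨
    m ×ₙ 1# + 0#  ≈⟨ +-congˡ -0#≈0# ⟨
    m ×ₙ 1# - 0#  ∎
  ⟦⟧-homo-⊖ 0       (suc n) = ≈-sym (+-identityˡ _)
  ⟦⟧-homo-⊖ (suc m) (suc n) = begin
    ⟦ suc m ⊖ suc n ⟧                  ≡⟨ cong ⟦_⟧ (ℤ.[1+m]⊖[1+n]≡m⊖n m n) ⟩
    ⟦ m ⊖ n ⟧                          ≈⟨ ⟦⟧-homo-⊖ m n ⟩
    m ×ₙ 1# - n ×ₙ 1#                  ≈⟨ +-identityˡ _ ⟨
    0# + (m ×ₙ 1# - n ×ₙ 1#)           ≈⟨ +-congʳ (-‿inverseʳ 1#) ⟨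
    (1# - 1#) + (m ×ₙ 1# - n ×ₙ 1#)    ≈⟨ interchange 1# (- 1#) (m ×ₙ 1#) (- (n ×ₙ 1#)) ⟩
    (1# + m ×ₙ 1#) + (- 1# - n ×ₙ 1#)  ≈⟨ +-congˡ (-‿+-comm 1# (n ×ₙ 1#)) ⟩
    (1# + m ×ₙ 1#) - (1# + n ×ₙ 1#)    ≈⟨ +-cong (1+× m 1#) (-‿cong (1+× n 1#)) ⟨
    suc m ×ₙ 1# - suc n ×ₙ 1#          ∎

  ⟦⟧-homo-‿ : ∀ i → ⟦ ℤ.- i ⟧ ≈ - ⟦ i ⟧
  ⟦⟧-homo-‿ (+ 0)       = ≈-sym -0#≈0#
  ⟦⟧-homo-‿ (+ suc n)   = ≈-refl
  ⟦⟧-homo-‿ -[1+ n ]    = ≈-sym (-‿involutive _)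

  ⟦⟧-homo-+ : ∀ i j → ⟦ i ℤ.+ j ⟧ ≈ ⟦ i ⟧ + ⟦ j ⟧
  ⟦⟧-homo-+ (+ m)      (+ n)      = ×-homo-+ 1# m n
  ⟦⟧-homo-+ (+ m)      -[1+ n ]   = ⟦⟧-homo-⊖ m (suc n)
  ⟦⟧-homo-+ -[1+ m ]   (+ n)      = ≈-trans (⟦⟧-homo-⊖ n (suc m)) (+-comm _ _)
  ⟦⟧-homo-+ -[1+ m ]   -[1+ n ]   = begin
    - (suc (suc (m ℕ.+ n)) ×ₙ 1#)  ≡⟨ cong (λ k → - (suc k ×ₙ 1#)) (ℕ.+-suc m n) ⟨
    - ((suc m ℕ.+ suc n) ×ₙ 1#)    ≈⟨ -‿cong (×-homo-+ 1# (suc m) (suc n)) ⟩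
    - (suc m ×ₙ 1# + suc n ×ₙ 1#)  ≈⟨ -‿+-comm _ _ ⟨
    - (suc m ×ₙ 1#) - suc n ×ₙ 1#  ∎

  ⟦⟧-homo-* : ∀ i j → ⟦ i ℤ.* j ⟧ ≈ ⟦ i ⟧ * ⟦ j ⟧
  ⟦⟧-homo-* (+ m)      (+ n)      = ≈-trans (reflexive (cong ⟦_⟧ (ℤ.+◃n≡+n (m ℕ.* n)))) (×1-homo-* m n)
  ⟦⟧-homo-* (+ m)      -[1+ n ]   = begin
    ⟦ Sign.- ◃ (m ℕ.* suc n) ⟧   ≡⟨ cong ⟦_⟧ (ℤ.-◃n≡-n (m ℕ.* suc n)) ⟩
    ⟦ ℤ.- + (m ℕ.* suc n) ⟧      ≈⟨ ⟦⟧-homo-‿ (+ (m ℕ.* suc n)) ⟩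
    - ((m ℕ.* suc n) ×ₙ 1#)      ≈⟨ -‿cong (×1-homo-* m (suc n)) ⟩
    - (m ×ₙ 1# * (suc n ×ₙ 1#))  ≈⟨ -‿distribʳ-* _ _ ⟩
    m ×ₙ 1# * - (suc n ×ₙ 1#)    ∎
  ⟦⟧-homo-* -[1+ m ]   (+ n)      = begin
    ⟦ Sign.- ◃ (suc m ℕ.* n) ⟧   ≡⟨ cong ⟦_⟧ (ℤ.-◃n≡-n (suc m ℕ.* n)) ⟩
    ⟦ ℤ.- + (suc m ℕ.* n) ⟧      ≈⟨ ⟦⟧-homo-‿ (+ (suc m ℕ.* n)) ⟩
    - ((suc m ℕ.* n) ×ₙ 1#)      ≈⟨ -‿cong (×1-homo-* (suc m) n) ⟩
    - (suc m ×ₙ 1# * (n ×ₙ 1#))  ≈⟨ -‿distribˡ-* _ _ ⟩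
    - (suc m ×ₙ 1#) * (n ×ₙ 1#)  ∎
  ⟦⟧-homo-* -[1+ m ]   -[1+ n ]   = begin
    (suc m ℕ.* suc n) ×ₙ 1#              ≈⟨ ×1-homo-* (suc m) (suc n) ⟩
    suc m ×ₙ 1# * (suc n ×ₙ 1#)          ≈⟨ -‿involutive _ ⟨
    - - (suc m ×ₙ 1# * (suc n ×ₙ 1#))    ≈⟨ -‿cong (-‿distribˡ-* _ _) ⟩
    - (- (suc m ×ₙ 1#) * (suc n ×ₙ 1#))  ≈⟨ -‿distribʳ-* _ _ ⟩
    - (suc m ×ₙ 1#) * - (suc n ×ₙ 1#)    ∎

  homomorphism : ℤ.+-*-rawRing -Raw-AlmostCommutative⟶ fromCommutativeRing R
  homomorphism = record
    { ⟦_⟧    = ⟦_⟧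
    ; +-homo = ⟦⟧-homo-+
    ; *-homo = ⟦⟧-homo-*
    ; -‿homo = ⟦⟧-homo-‿
    ; 0-homo = ≈-refl
    ; 1-homo = ≈-refl
    }

  _≟-coefficient_ : WeaklyDecidable (λ i j → ⟦ i ⟧ ≈ ⟦ j ⟧)
  i ≟-coefficient j with i ℤ.≟ j
  ... | yes refl = just ≈-refl
  ... | no _     = nothing

  open import Algebra.Solver.Ring ℤ.+-*-rawRing (fromCommutativeRing R) homomorphism _≟-coefficient_ public
    using (Polynomial; solve; _:=_; _:+_; _:*_; _:-_; :-_; con)

Fin-injective⇒surjective : ∀ {k} (f : Fin k → Fin k) → Injective _≡_ _≡_ f → ∀ j → ∃[ i ] f i ≡ j
Fin-injective⇒surjective {ℕ.zero}  f f-injective ()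
Fin-injective⇒surjective {ℕ.suc k} f f-injective j with Fin.any? (λ i → f i Fin.≟ j)
... | yes j∈image = j∈image
... | no  j∉image = contradiction (Fin.injective⇒≤ g-injective) ℕ.1+n≰n
  where
    j≢f : ∀ i → j ≢ f i
    j≢f i j≡fi = j∉image (i , sym j≡fi)

    g : Fin (ℕ.suc k) → Fin k
    g i = Fin.punchOut (j≢f i)

    g-injective : Injective _≡_ _≡_ g
    g-injective gi≡gi′ = f-injective (Fin.punchOut-injective (j≢f _) (j≢f _) gi≡gi′)

module FieldArithmetic (F : FiniteField) where
  open FiniteField F
  open FieldDefs F

  commutativeRing : CommutativeRing 0ℓ 0ℓ
  commutativeRing = record { isCommutativeRing = isCommutativeRing }

  open CommutativeRing commutativeRing public
    using (*-comm; zeroˡ; zeroʳ)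
  open import Algebra.Properties.Ring (CommutativeRing.ring commutativeRing) public
    using (x∙y⁻¹≈ε⇒x≈y; x≈y⇒x∙y⁻¹≈ε; -‿involutive; -0#≈0#)
  open IntegerCoefficientRingSolver commutativeRing public

  :1 : ∀ {n} → Polynomial n
  :1 = con (+ 1)

  :0 : ∀ {n} → Polynomial n
  :0 = con (+ 0)

  private variable
    x y c L R : Carrier

  x-y≡0⇒x≡y : x - y ≡ 0# → x ≡ y
  x-y≡0⇒x≡y = x∙y⁻¹≈ε⇒x≈y _ _

  x≢y⇒x-y≢0 : x ≢ y → x - y ≢ 0#
  x≢y⇒x-y≢0 x≢y = x≢y ∘ x-y≡0⇒x≡y

  x≢0⇒x*y≡0⇒y≡0 : x ≢ 0# → x * y ≡ 0# → y ≡ 0#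
  x≢0⇒x*y≡0⇒y≡0 {x} {y} x≢0 xy≡0 with inverse x x≢0
  ... | x⁻¹ , xx⁻¹≡1 = begin
    y               ≡⟨ solve 1 (λ y → y := :1 :* y) refl y ⟩
    1# * y          ≡⟨ cong (_* y) xx⁻¹≡1 ⟨
    x * x⁻¹ * y     ≡⟨ solve 3 (λ x x⁻¹ y → x :* x⁻¹ :* y := x⁻¹ :* (x :* y)) refl x x⁻¹ y ⟩
    x⁻¹ * (x * y)   ≡⟨ cong (x⁻¹ *_) xy≡0 ⟩
    x⁻¹ * 0#        ≡⟨ zeroʳ x⁻¹ ⟩
    0#              ∎
    where open ≡-Reasoning

  x*y≡0⇒x≡0⊎y≡0 : x * y ≡ 0# → x ≡ 0# ⊎ y ≡ 0#
  x*y≡0⇒x≡0⊎y≡0 {x} xy≡0 with x ≟ 0#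
  ... | yes x≡0 = inj₁ x≡0
  ... | no  x≢0 = inj₂ (x≢0⇒x*y≡0⇒y≡0 x≢0 xy≡0)

  *-≢0 : x ≢ 0# → y ≢ 0# → x * y ≢ 0#
  *-≢0 x≢0 y≢0 = y≢0 ∘ x≢0⇒x*y≡0⇒y≡0 x≢0

  -‿≢0 : x ≢ 0# → - x ≢ 0#
  -‿≢0 {x} x≢0 -x≡0 = x≢0 (trans (sym (-‿involutive x)) (trans (cong -_ -x≡0) -0#≈0#))

  difference-factor⇒≡ : c ≢ 0# → L ≡ R → L - R ≡ c * (x - y) → x ≡ y
  difference-factor⇒≡ c≢0 L≡R L-R≡c[x-y] =
    x-y≡0⇒x≡y (x≢0⇒x*y≡0⇒y≡0 c≢0 (trans (sym L-R≡c[x-y]) (x≈y⇒x∙y⁻¹≈ε L≡R)))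

  *-cancelˡ : c ≢ 0# → c * x ≡ c * y → x ≡ y
  *-cancelˡ {c} {x} {y} c≢0 cx≡cy = difference-factor⇒≡ c≢0 cx≡cy
    (solve 3 (λ c x y → c :* x :- c :* y := c :* (x :- y)) refl c x y)

  x*x≡y*y⇒x≡±y : x * x ≡ y * y → x ≡ y ⊎ x ≡ - y
  x*x≡y*y⇒x≡±y {x} {y} x²≡y² = Sum.map x-y≡0⇒x≡y x-y≡0⇒x≡y (x*y≡0⇒x≡0⊎y≡0 (begin
    (x - y) * (x - - y)  ≡⟨ solve 2 (λ x y → (x :- y) :* (x :- :- y) := x :* x :- y :* y) refl x y ⟩
    x * x - y * y        ≡⟨ x≈y⇒x∙y⁻¹≈ε x²≡y² ⟩
    0#                   ∎))
    where open ≡-Reasoning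

module Squares (F : FiniteField) where
  open FiniteField F
  open FieldDefs F
  open FieldArithmetic F

  private variable
    x y c d n m : Carrier

  x*x-isSquare : ∀ x → IsSquare (x * x)
  x*x-isSquare x = x , refl

  1-isSquare : IsSquare 1#
  1-isSquare = 1# , solve 0 (:1 :* :1 := :1) refl

  nonsquare⇒≢0 : Nonsquare x → x ≢ 0#
  nonsquare⇒≢0 x∉□ refl = x∉□ (0# , zeroˡ 0#)

  isSquare-* : IsSquare x → IsSquare y → IsSquare (x * y)
  isSquare-* (z , refl) (w , refl) =
    z * w , solve 2 (λ z w → (z :* w) :* (z :* w) := (z :* z) :* (w :* w)) refl z w

  isSquare-cancelˡ : x ≢ 0# → IsSquare x → IsSquare (x * y) → IsSquare y
  isSquare-cancelˡ {y = y} z²≢0 (z , refl) (w , w²≡z²y)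
    with inverse z (λ z≡0 → z²≢0 (trans (cong (_* z) z≡0) (zeroˡ z)))
  ... | z⁻¹ , zz⁻¹≡1 = w * z⁻¹ , (begin
    w * z⁻¹ * (w * z⁻¹)      ≡⟨ solve 2 (λ w z⁻¹ → w :* z⁻¹ :* (w :* z⁻¹) := w :* w :* (z⁻¹ :* z⁻¹)) refl w z⁻¹ ⟩
    w * w * (z⁻¹ * z⁻¹)      ≡⟨ cong (_* (z⁻¹ * z⁻¹)) w²≡z²y ⟩
    z * z * y * (z⁻¹ * z⁻¹)  ≡⟨ solve 3 (λ z z⁻¹ y → z :* z :* y :* (z⁻¹ :* z⁻¹)
                                                  := z :* z⁻¹ :* (z :* z⁻¹) :* y) refl z z⁻¹ y ⟩
    z * z⁻¹ * (z * z⁻¹) * y  ≡⟨ cong (λ t → t * t * y) zz⁻¹≡1 ⟩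
    1# * 1# * y              ≡⟨ solve 1 (λ y → :1 :* :1 :* y := y) refl y ⟩
    y                        ∎)
    where open ≡-Reasoning

  nonzeroSquare-scale : c ≢ 0# → d ≢ 0# → x * (c * c) ≡ d * d * y → NonzeroSquare x → NonzeroSquare y
  nonzeroSquare-scale {c} {d} {x} {y} c≢0 d≢0 xc²≡d²y (x≢0 , x□) = y≢0 , y□
    where
      y≢0 : y ≢ 0#
      y≢0 y≡0 = *-≢0 x≢0 (*-≢0 c≢0 c≢0) (trans xc²≡d²y (trans (cong (d * d *_) y≡0) (zeroʳ _)))
      y□ : IsSquare y
      y□ = isSquare-cancelˡ (*-≢0 d≢0 d≢0) (x*x-isSquare d)
             (subst IsSquare xc²≡d²y (isSquare-* x□ (x*x-isSquare c)))

  nonzeroSquare-scale⇔ : c ≢ 0# → d ≢ 0# → x * (c * c) ≡ d * d * y → NonzeroSquare x ⇔ NonzeroSquare y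
  nonzeroSquare-scale⇔ {c} {d} {x} {y} c≢0 d≢0 xc²≡d²y =
    mk⇔ (nonzeroSquare-scale c≢0 d≢0 xc²≡d²y) (nonzeroSquare-scale d≢0 c≢0 yd²≡c²x)
    where
      yd²≡c²x : y * (d * d) ≡ c * c * x
      yd²≡c²x = trans (*-comm y (d * d)) (trans (sym xc²≡d²y) (*-comm x (c * c)))

  private
    index : Carrier → Fin size
    index = Inverse.from enum

    index-injective : index x ≡ index y → x ≡ y
    index-injective {x} {y} ix≡iy = begin
      x                          ≡⟨ Inverse.strictlyInverseˡ enum x ⟨
      Inverse.to enum (index x)  ≡⟨ cong (Inverse.to enum) ix≡iy ⟩
      Inverse.to enum (index y)  ≡⟨ Inverse.strictlyInverseˡ enum y ⟩
      y                          ∎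
      where open ≡-Reasoning

  injective⇒surjective : (f : Carrier → Carrier) → (∀ {x y} → f x ≡ f y → x ≡ y) → ∀ y → ∃[ x ] f x ≡ y
  injective⇒surjective f f-injective y = Product.map (Inverse.to enum) index-injective
    (Fin-injective⇒surjective (index ∘ f ∘ Inverse.to enum) g-injective (index y))
    where
      g-injective : Injective _≡_ _≡_ (index ∘ f ∘ Inverse.to enum)
      g-injective {i} {j} gi≡gj = begin
        i                                ≡⟨ Inverse.strictlyInverseʳ enum i ⟨
        index (Inverse.to enum i)        ≡⟨ cong index (f-injective (index-injective gi≡gj)) ⟩
        index (Inverse.to enum j)        ≡⟨ Inverse.strictlyInverseʳ enum j ⟩
        j                                ∎
        where open ≡-Reasoning

  private
    -- The enumeration of F picks one element of each pair {x, - x} with x ≢ 0.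
    Positive : Carrier → Set
    Positive x = index x Fin.< index (- x)

    positive? : ∀ x → Dec (Positive x)
    positive? x = index x Fin.<? index (- x)

    positive⇒≢0 : Positive x → x ≢ 0#
    positive⇒≢0 pos refl = Fin.<-irrefl (cong index (sym -0#≈0#)) pos

    positive⇒-nonpositive : Positive x → ¬ Positive (- x)
    positive⇒-nonpositive {x} pos -pos =
      Fin.<-asym pos (subst (λ z → index (- x) Fin.< index z) (-‿involutive x) -pos)

    nonpositive-both⇒x≡-x : ¬ Positive x → ¬ Positive (- x) → x ≡ - x
    nonpositive-both⇒x≡-x {x} ¬pos ¬-pos = index-injective (Fin.≤-antisym
      (ℕ.≮⇒≥ (¬-pos ∘ subst (λ z → index (- x) Fin.< index z) (sym (-‿involutive x))))
      (ℕ.≮⇒≥ ¬pos))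

    positive-both-x≡±y⇒x≡y : Positive x → Positive y → x ≡ y ⊎ x ≡ - y → x ≡ y
    positive-both-x≡±y⇒x≡y _     _     (inj₁ x≡y)  = x≡y
    positive-both-x≡±y⇒x≡y pos-x pos-y (inj₂ refl) = ⊥-elim (positive⇒-nonpositive pos-y pos-x)

    nonpositive-both-x≡±y⇒x≡y : ¬ Positive x → ¬ Positive y → x ≡ y ⊎ x ≡ - y → x ≡ y
    nonpositive-both-x≡±y⇒x≡y _      _      (inj₁ x≡y)  = x≡y
    nonpositive-both-x≡±y⇒x≡y ¬pos-x ¬pos-y (inj₂ refl) = sym (nonpositive-both⇒x≡-x ¬pos-y ¬pos-x)

  -- θ below is injective, hence onto, and a nonsquare can only be hit as n x².
  module _ {n} (n∉□ : Nonsquare n) where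
    private
      θ : Carrier → Carrier
      θ x with positive? x
      ... | yes _ = x * x
      ... | no  _ = n * (x * x)

      square≢n*square : Positive x → x * x ≢ n * (y * y)
      square≢n*square {x} {y} pos x²≡ny² with y ≟ 0#
      ... | yes refl = *-≢0 x≢0 x≢0 (trans x²≡ny² (trans (cong (n *_) (zeroˡ 0#)) (zeroʳ n)))
        where x≢0 = positive⇒≢0 pos
      ... | no  y≢0  = n∉□ (isSquare-cancelˡ (*-≢0 y≢0 y≢0) (x*x-isSquare y)
                              (x , trans x²≡ny² (*-comm n (y * y))))

      θ-injective : θ x ≡ θ y → x ≡ y
      θ-injective {x} {y} with positive? x | positive? y
      ... | yes pos-x | yes pos-y =
        positive-both-x≡±y⇒x≡y pos-x pos-y ∘ x*x≡y*y⇒x≡±y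
      ... | no ¬pos-x | no ¬pos-y =
        nonpositive-both-x≡±y⇒x≡y ¬pos-x ¬pos-y ∘ x*x≡y*y⇒x≡±y ∘ *-cancelˡ (nonsquare⇒≢0 n∉□)
      ... | yes pos-x | no ¬pos-y = ⊥-elim ∘ square≢n*square pos-x
      ... | no ¬pos-x | yes pos-y = ⊥-elim ∘ square≢n*square pos-y ∘ sym

    nonsquare*nonsquare-isSquare : Nonsquare m → IsSquare (n * m)
    nonsquare*nonsquare-isSquare {m} m∉□ = from-preimage (injective⇒surjective θ θ-injective m)
      where
        from-preimage : ∃[ x ] θ x ≡ m → IsSquare (n * m)
        from-preimage (x , θx≡m) with positive? x | θx≡m
        ... | yes _ | x²≡m  = ⊥-elim (m∉□ (x , x²≡m))
        ... | no  _ | nx²≡m = n * x , (begin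
          n * x * (n * x)    ≡⟨ solve 2 (λ n x → n :* x :* (n :* x) := n :* (n :* (x :* x))) refl n x ⟩
          n * (n * (x * x))  ≡⟨ cong (n *_) nx²≡m ⟩
          n * m              ∎)
          where open ≡-Reasoning

  module _ (-1∉□ : Nonsquare (- 1#)) where

    isSquare⇒-nonsquare : x ≢ 0# → IsSquare x → Nonsquare (- x)
    isSquare⇒-nonsquare {x} x≢0 x□ -x□ = -1∉□ (isSquare-cancelˡ x≢0 x□ (subst IsSquare -x≡x*-1 -x□))
      where
        -x≡x*-1 : - x ≡ x * - 1#
        -x≡x*-1 = solve 1 (λ x → :- x := x :* (:- :1)) refl x

    nonsquare⇒-isSquare : Nonsquare x → IsSquare (- x)
    nonsquare⇒-isSquare {x} x∉□ = subst IsSquare -1*x≡-x (nonsquare*nonsquare-isSquare -1∉□ x∉□)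
      where
        -1*x≡-x : - 1# * x ≡ - x
        -1*x≡-x = solve 1 (λ x → :- :1 :* x := :- x) refl x

module ψ-Equation (F : FiniteField) where
  open FiniteField F
  open FieldDefs F
  open FieldArithmetic F
  open Squares F

  ψ-factor : Fin 2 → Carrier → Carrier → Carrier
  ψ-factor zero       a b = a
  ψ-factor (suc zero) a b = b

  ψ-Cls : ∀ {a b w} i → Cls i w → ψ a b w ≡ ψ-factor i a b * w
  ψ-Cls {a} {b} {w} zero       w□  = cong (if_then a * w else b * w) (dec-true (isSquare? w) w□)
  ψ-Cls {a} {b} {w} (suc zero) w∉□ = cong (if_then a * w else b * w) (dec-false (isSquare? w) w∉□)

  record ExplicitE (i j r s : Fin 2) (a b u v : Carrier) : Set where
    constructor explicitE
    field
      nonzero  : ¬ (u ≡ 0# × v ≡ 0#)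
      equation : ψ-factor r a b * (ψ-factor i a b * u - v)
               ≡ ψ-factor j a b * (- v) + ψ-factor s a b * (u - v - ψ-factor j a b * (- v))
      u-class  : Cls i u
      v-class  : Cls j (- v)
      w-class  : Cls r (ψ-factor i a b * u - v)
      t-class  : Cls s (u - v - ψ-factor j a b * (- v))

  InEcls⇒ExplicitE : ∀ {i j r s a b u v} → InEcls i j r s a b u v → ExplicitE i j r s a b u v
  InEcls⇒ExplicitE {i} {j} {r} {s} {a} {b} {u} {v} ((nz , eq) , cu , cv , cw , ct)
    with ψ a b u | ψ-Cls {a} {b} i cu | ψ a b (- v) | ψ-Cls {a} {b} j cv
  ... | _ | refl | _ | refl
    with ψ a b (ψ-factor i a b * u - v) | ψ-Cls {a} {b} r cw
       | ψ a b (u - v - ψ-factor j a b * (- v)) | ψ-Cls {a} {b} s ct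
  ... | _ | refl | _ | refl = explicitE nz eq cu cv cw ct

  ExplicitE⇒InEcls : ∀ {i j r s a b u v} → ExplicitE i j r s a b u v → InEcls i j r s a b u v
  ExplicitE⇒InEcls {i} {j} {r} {s} {a} {b} {u} {v} (explicitE nz eq cu cv cw ct)
    with ψ a b u | ψ-Cls {a} {b} i cu | ψ a b (- v) | ψ-Cls {a} {b} j cv
  ... | _ | refl | _ | refl
    with ψ a b (ψ-factor i a b * u - v) | ψ-Cls {a} {b} r cw
       | ψ a b (u - v - ψ-factor j a b * (- v)) | ψ-Cls {a} {b} s ct
  ... | _ | refl | _ | refl = (nz , eq) , cu , cv , cw , ct

  E-nonempty⇔ : ∀ {i j r s a b} {P : Set} →
    (∀ {u v} → ExplicitE i j r s a b u v → P) → (P → ∃[ u ] ∃[ v ] ExplicitE i j r s a b u v) →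
    (∃[ u ] ∃[ v ] InEcls i j r s a b u v) ⇔ P
  E-nonempty⇔ necessary sufficient = mk⇔
    (λ (_ , _ , e) → necessary (InEcls⇒ExplicitE e))
    (λ p → let (u , v , e) = sufficient p in u , v , ExplicitE⇒InEcls e)

  module _ (-1∉□ : Nonsquare (- 1#)) where

    E₀₀⁰⁰-empty : ∀ {a b u v} → InΣ a b → ¬ ExplicitE zero zero zero zero a b u v
    E₀₀⁰⁰-empty {a} {b} {u} {v} (_ , a≢0 , a≢1 , _) (explicitE nz eq u□ -v□ _ _) =
      isSquare⇒-nonsquare -1∉□ u≢0 u□ (subst (IsSquare ∘ -_) (sym u≡v) -v□)
      where
        u≡v : u ≡ v
        u≡v = difference-factor⇒≡ (*-≢0 a≢0 (x≢y⇒x-y≢0 a≢1)) eq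
          (solve 3 (λ a u v → a :* (a :* u :- v) :- (a :* (:- v) :+ a :* (u :- v :- a :* (:- v)))
                            := a :* (a :- :1) :* (u :- v)) refl a u v)
        u≢0 : u ≢ 0#
        u≢0 u≡0 = nz (u≡0 , trans (sym u≡v) u≡0)

    E₀₀¹¹-empty : ∀ {a b u v} → InΣ a b → ¬ ExplicitE zero zero (suc zero) (suc zero) a b u v
    E₀₀¹¹-empty {a} {b} {u} {v} (_ , a≢0 , a≢1 , b≢0 , b≢1 , ab□ , [1-a][1-b]□)
                (explicitE nz eq u□ -v□ _ _) =
      isSquare⇒-nonsquare -1∉□ N≢0 N□ (subst IsSquare (sym -N≡ab[1-a][1-b]u²) ab[1-a][1-b]u²□)
      where
        p q : Carrier
        p = b * (a - 1#)
        q = a * (b - 1#)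
        pu≡qv : p * u ≡ q * v
        pu≡qv = x-y≡0⇒x≡y (trans
          (solve 4 (λ a b u v → b :* (a :- :1) :* u :- a :* (b :- :1) :* v
                              := b :* (a :* u :- v) :- (a :* (:- v) :+ b :* (u :- v :- a :* (:- v))))
                   refl a b u v)
          (x≈y⇒x∙y⁻¹≈ε eq))
        p≢0 : p ≢ 0#
        p≢0 = *-≢0 b≢0 (x≢y⇒x-y≢0 a≢1)
        q≢0 : q ≢ 0#
        q≢0 = *-≢0 a≢0 (x≢y⇒x-y≢0 b≢1)
        u≢0 : u ≢ 0#
        u≢0 u≡0 = nz (u≡0 , x≢0⇒x*y≡0⇒y≡0 q≢0 (trans (sym pu≡qv) (trans (cong (p *_) u≡0) (zeroʳ p))))
        v≢0 : v ≢ 0#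
        v≢0 v≡0 = nz (x≢0⇒x*y≡0⇒y≡0 p≢0 (trans pu≡qv (trans (cong (q *_) v≡0) (zeroʳ q))) , v≡0)
        N : Carrier
        N = q * q * (u * - v)
        N≢0 : N ≢ 0#
        N≢0 = *-≢0 (*-≢0 q≢0 q≢0) (*-≢0 u≢0 (-‿≢0 v≢0))
        N□ : IsSquare N
        N□ = isSquare-* (x*x-isSquare q) (isSquare-* u□ -v□)
        -N≡ab[1-a][1-b]u² : - N ≡ a * b * ((1# - a) * (1# - b)) * (u * u)
        -N≡ab[1-a][1-b]u² = begin
          - N                ≡⟨ solve 4 (λ a b u v → :- (a :* (b :- :1) :* (a :* (b :- :1)) :* (u :* :- v))
                                                   := a :* (b :- :1) :* (a :* (b :- :1) :* v) :* u)
                                        refl a b u v ⟩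
          q * (q * v) * u    ≡⟨ cong (λ z → q * z * u) pu≡qv ⟨
          q * (p * u) * u    ≡⟨ solve 3 (λ a b u → a :* (b :- :1) :* (b :* (a :- :1) :* u) :* u
                                                 := a :* b :* ((:1 :- a) :* (:1 :- b)) :* (u :* u))
                                        refl a b u ⟩
          a * b * ((1# - a) * (1# - b)) * (u * u) ∎
          where open ≡-Reasoning
        ab[1-a][1-b]u²□ : IsSquare (a * b * ((1# - a) * (1# - b)) * (u * u))
        ab[1-a][1-b]u²□ = isSquare-* (isSquare-* ab□ [1-a][1-b]□) (x*x-isSquare u)

    E₀₁¹⁰⇒squares : ∀ {a b u v} → InΣ a b → ExplicitE zero (suc zero) (suc zero) zero a b u v →
                    NonzeroSquare b × NonzeroSquare (1# - b)
    E₀₁¹⁰⇒squares {a} {b} {u} {v} (_ , a≢0 , a≢1 , b≢0 , b≢1 , _ , [1-a][1-b]□)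
                  (explicitE nz eq u□ _ w∉□ t□) =
      (b≢0 , b□) , (x≢y⇒x-y≢0 (≢-sym b≢1) , isSquare-cancelˡ (x≢y⇒x-y≢0 (≢-sym a≢1)) 1-a□ [1-a][1-b]□)
      where
        u≡v : u ≡ v
        u≡v = difference-factor⇒≡ (*-≢0 a≢0 (x≢y⇒x-y≢0 b≢1)) eq
          (solve 4 (λ a b u v → b :* (a :* u :- v) :- (b :* (:- v) :+ a :* (u :- v :- b :* (:- v)))
                              := a :* (b :- :1) :* (u :- v)) refl a b u v)
        u≢0 : u ≢ 0#
        u≢0 u≡0 = nz (u≡0 , trans (sym u≡v) u≡0)
        a-1∉□ : Nonsquare (a - 1#)
        a-1∉□ a-1□ = w∉□ (subst IsSquare [a-1]u≡au-v (isSquare-* a-1□ u□))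
          where
            [a-1]u≡au-v : (a - 1#) * u ≡ a * u - v
            [a-1]u≡au-v = trans (solve 2 (λ a u → (a :- :1) :* u := a :* u :- u) refl a u)
                                (cong (λ z → a * u - z) u≡v)
        1-a□ : IsSquare (1# - a)
        1-a□ = subst IsSquare (solve 1 (λ a → :- (a :- :1) := :1 :- a) refl a)
                 (nonsquare⇒-isSquare -1∉□ a-1∉□)
        b□ : IsSquare b
        b□ = isSquare-cancelˡ u≢0 u□ (subst IsSquare t≡ub t□)
          where
            t≡ub : u - v - b * - v ≡ u * b
            t≡ub = trans (cong (λ z → u - z - b * - z) (sym u≡v))
                         (solve 2 (λ u b → u :- u :- b :* (:- u) := u :* b) refl u b)

    squares⇒E₀₁¹⁰ : ∀ {a b} → InΣ a b → NonzeroSquare b × NonzeroSquare (1# - b) →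
                    ExplicitE zero (suc zero) (suc zero) zero a b 1# 1#
    squares⇒E₀₁¹⁰ {a} {b} (_ , _ , a≢1 , _ , _ , _ , [1-a][1-b]□) ((_ , b□) , (1-b≢0 , 1-b□)) = explicitE
      (λ (1≡0 , _) → 0≢1 (sym 1≡0))
      (solve 2 (λ a b → b :* (a :* :1 :- :1) := b :* (:- :1) :+ a :* (:1 :- :1 :- b :* (:- :1))) refl a b)
      1-isSquare
      -1∉□
      (subst Nonsquare (solve 1 (λ a → :- (:1 :- a) := a :* :1 :- :1) refl a)
             (isSquare⇒-nonsquare -1∉□ (x≢y⇒x-y≢0 (≢-sym a≢1)) 1-a□))
      (subst IsSquare (solve 1 (λ b → b := :1 :- :1 :- b :* (:- :1)) refl b) b□)
      where
        1-a□ : IsSquare (1# - a)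
        1-a□ = isSquare-cancelˡ 1-b≢0 1-b□ (subst IsSquare (*-comm (1# - a) (1# - b)) [1-a][1-b]□)

    E₁₀⁰¹⇒squares : ∀ {a b u v} → InΣ a b → ExplicitE (suc zero) zero zero (suc zero) a b u v →
                    NonzeroSquare b × NonzeroSquare (1# - b)
    E₁₀⁰¹⇒squares {a} {b} {u} {v} (_ , a≢0 , a≢1 , b≢0 , b≢1 , ab□ , _)
                  (explicitE _ eq u∉□ -v□ w□ t∉□) =
      (b≢0 , isSquare-cancelˡ a≢0 a□ ab□) , (x≢y⇒x-y≢0 (≢-sym b≢1) , 1-b□)
      where
        u≡v : u ≡ v
        u≡v = difference-factor⇒≡ (*-≢0 b≢0 (x≢y⇒x-y≢0 a≢1)) eq
          (solve 4 (λ a b u v → a :* (b :* u :- v) :- (a :* (:- v) :+ b :* (u :- v :- a :* (:- v)))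
                              := b :* (a :- :1) :* (u :- v)) refl a b u v)
        1-b□ : IsSquare (1# - b)
        1-b□ = isSquare-cancelˡ (-‿≢0 (nonsquare⇒≢0 u∉□)) (subst (IsSquare ∘ -_) (sym u≡v) -v□)
                 (subst IsSquare w≡-u[1-b] w□)
          where
            w≡-u[1-b] : b * u - v ≡ - u * (1# - b)
            w≡-u[1-b] = trans (cong (λ z → b * u - z) (sym u≡v))
                              (solve 2 (λ u b → b :* u :- u := :- u :* (:1 :- b)) refl u b)
        -- were a a nonsquare, t = a u would be a product of nonsquares, hence a square
        a□ : IsSquare a
        a□ with isSquare? a
        ... | yes a□  = a□
        ... | no  a∉□ = ⊥-elim (t∉□ (subst IsSquare au≡t (nonsquare*nonsquare-isSquare a∉□ u∉□)))
          where
            au≡t : a * u ≡ u - v - a * - v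
            au≡t = trans (solve 2 (λ a u → a :* u := u :- u :- a :* (:- u)) refl a u)
                         (cong (λ z → u - z - a * - z) u≡v)

    squares⇒E₁₀⁰¹ : ∀ {a b} → InΣ a b → NonzeroSquare b × NonzeroSquare (1# - b) →
                    ExplicitE (suc zero) zero zero (suc zero) a b (- 1#) (- 1#)
    squares⇒E₁₀⁰¹ {a} {b} (_ , a≢0 , _ , b≢0 , _ , ab□ , _) ((_ , b□) , (_ , 1-b□)) = explicitE
      (λ (-1≡0 , _) → nonsquare⇒≢0 -1∉□ -1≡0)
      (solve 2 (λ a b → a :* (b :* (:- :1) :- (:- :1))
                      := a :* (:- (:- :1)) :+ b :* (:- :1 :- (:- :1) :- a :* (:- (:- :1)))) refl a b)
      -1∉□
      (subst IsSquare (sym (-‿involutive 1#)) 1-isSquare)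
      (subst IsSquare (solve 1 (λ b → :1 :- b := b :* (:- :1) :- (:- :1)) refl b) 1-b□)
      (subst Nonsquare (solve 1 (λ a → :- a := :- :1 :- (:- :1) :- a :* (:- (:- :1))) refl a)
             (isSquare⇒-nonsquare -1∉□ a≢0 a□))
      where
        a□ : IsSquare a
        a□ = isSquare-cancelˡ b≢0 b□ (subst IsSquare (*-comm a b) ab□)

    -- b - a + a b = 0 would give a b = a² (1 - b), making 1 - b = - (b - 1) a square as well
    b-a+ab≢0 : ∀ {a b} → InΣ a b → IsSquare (b - 1#) → b - a + a * b ≢ 0#
    b-a+ab≢0 {a} {b} (_ , a≢0 , _ , _ , b≢1 , ab□ , _) b-1□ T≡0 =
      isSquare⇒-nonsquare -1∉□ (x≢y⇒x-y≢0 b≢1) b-1□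
        (subst IsSquare (solve 1 (λ b → :1 :- b := :- (b :- :1)) refl b)
          (isSquare-cancelˡ (*-≢0 a≢0 a≢0) (x*x-isSquare a) (subst IsSquare ab≡a²[1-b] ab□)))
      where
        ab≡a²[1-b] : a * b ≡ a * a * (1# - b)
        ab≡a²[1-b] = x-y≡0⇒x≡y (begin
          a * b - a * a * (1# - b)  ≡⟨ solve 2 (λ a b → a :* b :- a :* a :* (:1 :- b) := a :* (b :- a :+ a :* b))
                                               refl a b ⟩
          a * (b - a + a * b)       ≡⟨ cong (a *_) T≡0 ⟩
          a * 0#                    ≡⟨ zeroʳ a ⟩
          0#                        ∎)
          where open ≡-Reasoning

    E₀₁⁰⁰⇒squares : ∀ {a b u v} → InΣ a b → ExplicitE zero (suc zero) zero zero a b u v →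
                    NonzeroSquare (b - 1#) × NonzeroSquare (b * (b - a + a * b))
    E₀₁⁰⁰⇒squares {a} {b} {u} {v} σ@(_ , a≢0 , a≢1 , b≢0 , b≢1 , ab□ , _) (explicitE nz eq u□ _ w□ t□) =
      (x≢y⇒x-y≢0 b≢1 , b-1□) , (*-≢0 b≢0 (b-a+ab≢0 σ b-1□) , T□)
      where
        au≡bv : a * u ≡ b * v
        au≡bv = difference-factor⇒≡ (x≢y⇒x-y≢0 a≢1) eq
          (solve 4 (λ a b u v → a :* (a :* u :- v) :- (b :* (:- v) :+ a :* (u :- v :- b :* (:- v)))
                              := (a :- :1) :* (a :* u :- b :* v)) refl a b u v)
        u≢0 : u ≢ 0#
        u≢0 u≡0 = nz (u≡0 , x≢0⇒x*y≡0⇒y≡0 b≢0 (trans (sym au≡bv) (trans (cong (a *_) u≡0) (zeroʳ a))))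
        b-1□ : IsSquare (b - 1#)
        b-1□ = isSquare-cancelˡ (*-≢0 (*-≢0 a≢0 a≢0) u≢0) (isSquare-* (x*x-isSquare a) u□)
                 (subst IsSquare ab[au-v]≡a²u[b-1] (isSquare-* ab□ w□))
          where
            ab[au-v]≡a²u[b-1] : a * b * (a * u - v) ≡ a * a * u * (b - 1#)
            ab[au-v]≡a²u[b-1] = begin
              a * b * (a * u - v)          ≡⟨ solve 4 (λ a b u v → a :* b :* (a :* u :- v)
                                                               := a :* (b :* (a :* u) :- b :* v)) refl a b u v ⟩
              a * (b * (a * u) - b * v)    ≡⟨ cong (λ z → a * (b * (a * u) - z)) au≡bv ⟨
              a * (b * (a * u) - a * u)    ≡⟨ solve 3 (λ a b u → a :* (b :* (a :* u) :- a :* u)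
                                                             := a :* a :* u :* (b :- :1)) refl a b u ⟩
              a * a * u * (b - 1#)         ∎
              where open ≡-Reasoning
        T□ : IsSquare (b * (b - a + a * b))
        T□ = isSquare-cancelˡ u≢0 u□ (subst IsSquare b²t≡uT (isSquare-* (x*x-isSquare b) t□))
          where
            b²t≡uT : b * b * (u - v - b * - v) ≡ u * (b * (b - a + a * b))
            b²t≡uT = begin
              b * b * (u - v - b * - v)          ≡⟨ solve 3 (λ b u v → b :* b :* (u :- v :- b :* (:- v))
                                                                   := b :* (b :* u :- b :* v :+ b :* (b :* v)))
                                                            refl b u v ⟩
              b * (b * u - b * v + b * (b * v))  ≡⟨ cong (λ z → b * (b * u - z + b * z)) au≡bv ⟨
              b * (b * u - a * u + b * (a * u))  ≡⟨ solve 3 (λ a b u → b :* (b :* u :- a :* u :+ b :* (a :* u))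
                                                                   := u :* (b :* (b :- a :+ a :* b))) refl a b u ⟩
              u * (b * (b - a + a * b))          ∎
              where open ≡-Reasoning

    squares⇒E₀₁⁰⁰ : ∀ {a b} → InΣ a b → NonzeroSquare (b - 1#) × NonzeroSquare (b * (b - a + a * b)) →
                    ExplicitE zero (suc zero) zero zero a b (b * b) (a * b)
    squares⇒E₀₁⁰⁰ {a} {b} (_ , a≢0 , _ , b≢0 , _ , ab□ , _) ((_ , b-1□) , (_ , T□)) = explicitE
      (λ (b²≡0 , _) → *-≢0 b≢0 b≢0 b²≡0)
      (solve 2 (λ a b → a :* (a :* (b :* b) :- a :* b)
                      := b :* (:- (a :* b)) :+ a :* (b :* b :- a :* b :- b :* (:- (a :* b)))) refl a b)
      (x*x-isSquare b)
      (isSquare⇒-nonsquare -1∉□ (*-≢0 a≢0 b≢0) ab□)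
      (subst IsSquare (solve 2 (λ a b → a :* b :* (b :- :1) := a :* (b :* b) :- a :* b) refl a b)
             (isSquare-* ab□ b-1□))
      (subst IsSquare (solve 2 (λ a b → b :* (b :- a :+ a :* b) := b :* b :- a :* b :- b :* (:- (a :* b))) refl a b)
             T□)

    E₀₁¹⁰-nonempty⇔ : ∀ {a b} → InΣ a b →
      (∃[ u ] ∃[ v ] InEcls zero (suc zero) (suc zero) zero a b u v) ⇔ (NonzeroSquare b × NonzeroSquare (1# - b))
    E₀₁¹⁰-nonempty⇔ σ = E-nonempty⇔ (E₀₁¹⁰⇒squares σ) (λ squares → _ , _ , squares⇒E₀₁¹⁰ σ squares)

    E₁₀⁰¹-nonempty⇔ : ∀ {a b} → InΣ a b →
      (∃[ u ] ∃[ v ] InEcls (suc zero) zero zero (suc zero) a b u v) ⇔ (NonzeroSquare b × NonzeroSquare (1# - b))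
    E₁₀⁰¹-nonempty⇔ σ = E-nonempty⇔ (E₁₀⁰¹⇒squares σ) (λ squares → _ , _ , squares⇒E₁₀⁰¹ σ squares)

    E₀₁⁰⁰-nonempty⇔ : ∀ {a b} → InΣ a b →
      (∃[ u ] ∃[ v ] InEcls zero (suc zero) zero zero a b u v)
        ⇔ (NonzeroSquare (b - 1#) × NonzeroSquare (b * (b - a + a * b)))
    E₀₁⁰⁰-nonempty⇔ σ = E-nonempty⇔ (E₀₁⁰⁰⇒squares σ) (λ squares → _ , _ , squares⇒E₀₁⁰⁰ σ squares)

module Ψ-Map (F : FiniteField) where
  open FiniteField F
  open FieldDefs F
  open FieldArithmetic F
  open Squares F

  module _ {a b x y} (Ψ : ΨIs a b x y) where
    private
      substitute : (f : Carrier → Carrier → Carrier) → f (x * b) (y * (1# - b)) ≡ f a (1# - a)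
      substitute f = cong₂ f (proj₁ Ψ) (proj₂ Ψ)

    Ψ-identity₁ : (1# - y) * (x - y) * (b * (1# - b) * (b * (1# - b))) ≡ (a - b) * (a - b) * b
    Ψ-identity₁ = begin
      (1# - y) * (x - y) * (b * (1# - b) * (b * (1# - b)))
        ≡⟨ solve 3 (λ x y b → (:1 :- y) :* (x :- y) :* (b :* (:1 :- b) :* (b :* (:1 :- b)))
                           := ((:1 :- b) :- y :* (:1 :- b)) :* (x :* b :* (:1 :- b) :- y :* (:1 :- b) :* b) :* b) refl x y b ⟩
      ((1# - b) - y * (1# - b)) * (x * b * (1# - b) - y * (1# - b) * b) * b
        ≡⟨ substitute (λ X Y → ((1# - b) - Y) * (X * (1# - b) - Y * b) * b) ⟩
      ((1# - b) - (1# - a)) * (a * (1# - b) - (1# - a) * b) * b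
        ≡⟨ solve 2 (λ a b → ((:1 :- b) :- (:1 :- a)) :* (a :* (:1 :- b) :- (:1 :- a) :* b) :* b
                         := (a :- b) :* (a :- b) :* b) refl a b ⟩
      (a - b) * (a - b) * b ∎
      where open ≡-Reasoning

    Ψ-identity₂ : (1# - x) * (y - x) * (b * (1# - b) * (b * (1# - b))) ≡ (a - b) * (a - b) * (1# - b)
    Ψ-identity₂ = begin
      (1# - x) * (y - x) * (b * (1# - b) * (b * (1# - b)))
        ≡⟨ solve 3 (λ x y b → (:1 :- x) :* (y :- x) :* (b :* (:1 :- b) :* (b :* (:1 :- b)))
                           := (b :- x :* b) :* (y :* (:1 :- b) :* b :- x :* b :* (:1 :- b)) :* (:1 :- b)) refl x y b ⟩
      (b - x * b) * (y * (1# - b) * b - x * b * (1# - b)) * (1# - b)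
        ≡⟨ substitute (λ X Y → (b - X) * (Y * b - X * (1# - b)) * (1# - b)) ⟩
      (b - a) * ((1# - a) * b - a * (1# - b)) * (1# - b)
        ≡⟨ solve 2 (λ a b → (b :- a) :* ((:1 :- a) :* b :- a :* (:1 :- b)) :* (:1 :- b)
                         := (a :- b) :* (a :- b) :* (:1 :- b)) refl a b ⟩
      (a - b) * (a - b) * (1# - b) ∎
      where open ≡-Reasoning

    Ψ-identity₃ : (x - 1#) * (y - x) * (b * (b - 1#) * (b * (b - 1#))) ≡ (a - b) * (a - b) * (b - 1#)
    Ψ-identity₃ = begin
      (x - 1#) * (y - x) * (b * (b - 1#) * (b * (b - 1#)))
        ≡⟨ solve 3 (λ x y b → (x :- :1) :* (y :- x) :* (b :* (b :- :1) :* (b :* (b :- :1)))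
                           := (x :* b :- b) :* (x :* b :* (:1 :- b) :- y :* (:1 :- b) :* b) :* (b :- :1)) refl x y b ⟩
      (x * b - b) * (x * b * (1# - b) - y * (1# - b) * b) * (b - 1#)
        ≡⟨ substitute (λ X Y → (X - b) * (X * (1# - b) - Y * b) * (b - 1#)) ⟩
      (a - b) * (a * (1# - b) - (1# - a) * b) * (b - 1#)
        ≡⟨ solve 2 (λ a b → (a :- b) :* (a :* (:1 :- b) :- (:1 :- a) :* b) :* (b :- :1)
                         := (a :- b) :* (a :- b) :* (b :- :1)) refl a b ⟩
      (a - b) * (a - b) * (b - 1#) ∎
      where open ≡-Reasoning

    Ψ-identity₄ : (x * x - (1# + 1#) * x + y) * (y - x) * (b * b * (1# - b) * (b * b * (1# - b)))
                ≡ (a - b) * (a - b) * (b * (b - a + a * b))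
    Ψ-identity₄ = begin
      (x * x - (1# + 1#) * x + y) * (y - x) * (b * b * (1# - b) * (b * b * (1# - b)))
        ≡⟨ solve 3 (λ x y b → (x :* x :- (:1 :+ :1) :* x :+ y) :* (y :- x) :* (b :* b :* (:1 :- b) :* (b :* b :* (:1 :- b)))
                           := (x :* b :* (x :* b) :* (:1 :- b) :- (:1 :+ :1) :* (x :* b) :* b :* (:1 :- b) :+ y :* (:1 :- b) :* b :* b)
                              :* (y :* (:1 :- b) :* b :- x :* b :* (:1 :- b)) :* b) refl x y b ⟩
      (x * b * (x * b) * (1# - b) - (1# + 1#) * (x * b) * b * (1# - b) + y * (1# - b) * b * b)
        * (y * (1# - b) * b - x * b * (1# - b)) * b
        ≡⟨ substitute (λ X Y → (X * X * (1# - b) - (1# + 1#) * X * b * (1# - b) + Y * b * b) * (Y * b - X * (1# - b)) * b) ⟩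
      (a * a * (1# - b) - (1# + 1#) * a * b * (1# - b) + (1# - a) * b * b) * ((1# - a) * b - a * (1# - b)) * b
        ≡⟨ solve 2 (λ a b → (a :* a :* (:1 :- b) :- (:1 :+ :1) :* a :* b :* (:1 :- b) :+ (:1 :- a) :* b :* b)
                             :* ((:1 :- a) :* b :- a :* (:1 :- b)) :* b
                         := (a :- b) :* (a :- b) :* (b :* (b :- a :+ a :* b))) refl a b ⟩
      (a - b) * (a - b) * (b * (b - a + a * b)) ∎
      where open ≡-Reasoning

  Ψ-square-conditions₁ : ∀ {a b x y} → InΣ a b → ΨIs a b x y →
    (NonzeroSquare ((1# - y) * (x - y)) × NonzeroSquare ((1# - x) * (y - x)))
      ⇔ (NonzeroSquare b × NonzeroSquare (1# - b))
  Ψ-square-conditions₁ {a} {b} (a≢b , _ , _ , b≢0 , b≢1 , _) Ψ =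
    nonzeroSquare-scale⇔ c≢0 a-b≢0 (Ψ-identity₁ Ψ) ×-⇔ nonzeroSquare-scale⇔ c≢0 a-b≢0 (Ψ-identity₂ Ψ)
    where
      c≢0 : b * (1# - b) ≢ 0#
      c≢0 = *-≢0 b≢0 (x≢y⇒x-y≢0 (≢-sym b≢1))
      a-b≢0 : a - b ≢ 0#
      a-b≢0 = x≢y⇒x-y≢0 a≢b

  Ψ-square-conditions₂ : ∀ {a b x y} → InΣ a b → ΨIs a b x y →
    (NonzeroSquare ((x - 1#) * (y - x)) × NonzeroSquare ((x * x - (1# + 1#) * x + y) * (y - x)))
      ⇔ (NonzeroSquare (b - 1#) × NonzeroSquare (b * (b - a + a * b)))
  Ψ-square-conditions₂ {a} {b} (a≢b , _ , _ , b≢0 , b≢1 , _) Ψ =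
    nonzeroSquare-scale⇔ (*-≢0 b≢0 (x≢y⇒x-y≢0 b≢1)) a-b≢0 (Ψ-identity₃ Ψ)
      ×-⇔ nonzeroSquare-scale⇔ (*-≢0 (*-≢0 b≢0 b≢0) (x≢y⇒x-y≢0 (≢-sym b≢1))) a-b≢0 (Ψ-identity₄ Ψ)
    where
      a-b≢0 : a - b ≢ 0#
      a-b≢0 = x≢y⇒x-y≢0 a≢b

  ΨIs⇒InΣ : ∀ {a b x y} → InS x y → b ≢ 0# → ΨIs a b x y → InΣ a b
  ΨIs⇒InΣ {b = b} {x} {y} (x□ , y□ , _ , x≢0 , x≢1 , y≢0 , _) b≢0 (refl , y[1-b]≡1-xb) =
    xb≢b , *-≢0 x≢0 b≢0 , xb≢1 , b≢0 , b≢1 , xb*b□ , [1-xb][1-b]□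
    where
      open ≡-Reasoning
      b≢1 : b ≢ 1#
      b≢1 b≡1 = x≢1 (begin
        x       ≡⟨ solve 1 (λ x → x := x :* :1) refl x ⟩
        x * 1#  ≡⟨ cong (x *_) b≡1 ⟨
        x * b   ≡⟨ x-y≡0⇒x≡y 1-xb≡0 ⟨
        1#      ∎)
        where
          1-xb≡0 : 1# - x * b ≡ 0#
          1-xb≡0 = begin
            1# - x * b     ≡⟨ y[1-b]≡1-xb ⟨
            y * (1# - b)   ≡⟨ cong (λ z → y * (1# - z)) b≡1 ⟩
            y * (1# - 1#)  ≡⟨ solve 1 (λ y → y :* (:1 :- :1) := :0) refl y ⟩
            0#             ∎
      xb≢1 : x * b ≢ 1#
      xb≢1 xb≡1 = [ y≢0 , x≢y⇒x-y≢0 (≢-sym b≢1) ] (x*y≡0⇒x≡0⊎y≡0 (begin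
        y * (1# - b)  ≡⟨ y[1-b]≡1-xb ⟩
        1# - x * b    ≡⟨ cong (λ z → 1# - z) xb≡1 ⟩
        1# - 1#       ≡⟨ x≈y⇒x∙y⁻¹≈ε refl ⟩
        0#            ∎))
      xb≢b : x * b ≢ b
      xb≢b xb≡b = [ x≢1 ∘ x-y≡0⇒x≡y , b≢0 ] (x*y≡0⇒x≡0⊎y≡0 (begin
        (x - 1#) * b  ≡⟨ solve 2 (λ x b → (x :- :1) :* b := x :* b :- b) refl x b ⟩
        x * b - b     ≡⟨ x≈y⇒x∙y⁻¹≈ε xb≡b ⟩
        0#            ∎))
      xb*b□ : IsSquare (x * b * b)
      xb*b□ = subst IsSquare (solve 2 (λ x b → x :* (b :* b) := x :* b :* b) refl x b)
                (isSquare-* x□ (x*x-isSquare b))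
      [1-xb][1-b]□ : IsSquare ((1# - x * b) * (1# - b))
      [1-xb][1-b]□ = subst IsSquare (begin
        y * ((1# - b) * (1# - b))  ≡⟨ solve 2 (λ y b → y :* ((:1 :- b) :* (:1 :- b)) := y :* (:1 :- b) :* (:1 :- b))
                                              refl y b ⟩
        y * (1# - b) * (1# - b)    ≡⟨ cong (_* (1# - b)) y[1-b]≡1-xb ⟩
        (1# - x * b) * (1# - b)    ∎)
        (isSquare-* y□ (x*x-isSquare (1# - b)))

  Ψ-surjective : ∀ {x y} → InS x y → ∃[ b ] InΣ (x * b) b × ΨIs (x * b) b x y
  Ψ-surjective {x} {y} xy∈S@(_ , _ , x≢y , _ , _ , _ , y≢1) with inverse (x - y) (x≢y⇒x-y≢0 x≢y)
  ... | d , [x-y]d≡1 = b , ΨIs⇒InΣ xy∈S b≢0 Ψ , Ψ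
    where
      b : Carrier
      b = (1# - y) * d
      d≢0 : d ≢ 0#
      d≢0 d≡0 = 0≢1 (trans (sym (zeroʳ (x - y))) (trans (cong ((x - y) *_) (sym d≡0)) [x-y]d≡1))
      b≢0 : b ≢ 0#
      b≢0 = *-≢0 (x≢y⇒x-y≢0 (≢-sym y≢1)) d≢0
      Ψ : ΨIs (x * b) b x y
      Ψ = refl , x-y≡0⇒x≡y (begin
        y * (1# - b) - (1# - x * b)    ≡⟨ solve 3 (λ x y d → y :* (:1 :- (:1 :- y) :* d) :- (:1 :- x :* ((:1 :- y) :* d))
                                                         := (:1 :- y) :* ((x :- y) :* d :- :1)) refl x y d ⟩
        (1# - y) * ((x - y) * d - 1#)  ≡⟨ cong (λ z → (1# - y) * (z - 1#)) [x-y]d≡1 ⟩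
        (1# - y) * (1# - 1#)           ≡⟨ solve 1 (λ y → (:1 :- y) :* (:1 :- :1) := :0) refl y ⟩
        0#                             ∎)
        where open ≡-Reasoning

  InScls-characterisation : ∀ {i j r s x y} {P Q : Carrier → Carrier → Set} →
    (∀ {a b} → InΣ a b → (∃[ u ] ∃[ v ] InEcls i j r s a b u v) ⇔ P a b) →
    (∀ {a b x y} → InΣ a b → ΨIs a b x y → Q x y ⇔ P a b) →
    InS x y → InScls i j r s x y ⇔ Q x y
  InScls-characterisation {x = x} E⇔P Q⇔P xy∈S = mk⇔
    (λ (a , b , (σ , uv) , Ψ) → Equivalence.from (Q⇔P σ Ψ) (Equivalence.to (E⇔P σ) uv))
    (λ Q[x,y] → let (b , σ , Ψ) = Ψ-surjective xy∈S in
      x * b , b , (σ , Equivalence.from (E⇔P σ) (Equivalence.to (Q⇔P σ Ψ) Q[x,y])) , Ψ)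

lemma2p5 : (F : FiniteField) →
    let open FiniteField F
        open FieldDefs F
    in OddPrimePower size → Nonsquare (- 1#) →
       (∀ x y → ¬ InScls zero zero zero zero x y)
     × (∀ x y → ¬ InScls zero zero (suc zero) (suc zero) x y)
     × (∀ x y → InS x y →
          (InScls zero (suc zero) (suc zero) zero x y ⇔ InScls (suc zero) zero zero (suc zero) x y)
        × (InScls (suc zero) zero zero (suc zero) x y
            ⇔ (NonzeroSquare ((1# - y) * (x - y)) × NonzeroSquare ((1# - x) * (y - x)))))
     × (∀ x y → InS x y →
          InScls zero (suc zero) zero zero x y
            ⇔ (NonzeroSquare ((x - 1#) * (y - x))
              × NonzeroSquare ((x * x - (1# + 1#) * x + y) * (y - x))))
-- The characteristic is odd because - 1 is a nonsquare.
lemma2p5 F _ -1∉□ =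
    (λ _ _ (_ , _ , (σ , _ , _ , e) , _) → E₀₀⁰⁰-empty -1∉□ σ (InEcls⇒ExplicitE e))
  , (λ _ _ (_ , _ , (σ , _ , _ , e) , _) → E₀₀¹¹-empty -1∉□ σ (InEcls⇒ExplicitE e))
  , (λ _ _ xy∈S →
       ⇔.trans (InScls-characterisation (E₀₁¹⁰-nonempty⇔ -1∉□) Ψ-square-conditions₁ xy∈S)
               (⇔.sym (InScls-characterisation (E₁₀⁰¹-nonempty⇔ -1∉□) Ψ-square-conditions₁ xy∈S))
     , InScls-characterisation (E₁₀⁰¹-nonempty⇔ -1∉□) Ψ-square-conditions₁ xy∈S)
  , (λ _ _ → InScls-characterisation (E₀₁⁰⁰-nonempty⇔ -1∉□) Ψ-square-conditions₂)
  where
    open ψ-Equation F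
    open Ψ-Map F
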